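{- Let $p$ be a prime and let $\varphi\in\mathbb{Z}[x]$ be a polynomial not divisible by $p$. For nonnegative integers $l,m$ let $I=\langle p^l,\varphi^m\rangle$ be the ideal of $\mathbb{Z}[x]$ generated by $p^l$ and $\varphi^m$. Then (1) $I:\langle p^i\rangle=\langle p^{l-i},\varphi^m\rangle$ for every integer $0\le i\le l$, and (2) $I:\langle \varphi^j\rangle=\langle p^{l},\varphi^{m-j}\rangle$ for every integer $0\le j\le m$.
   Context: For ideals $I,J$ of a commutative ring $A$, the quotient ideal is $I:J=\{a\in A\mid aJ\subseteq I\}$. -}

module Defs where

open import Level using (0ℓ)
open import Data.Nat using (ℕ; zero; suc)
open import Data.Integer using (ℤ; +_) renaming (_+_ to _+ℤ_; _*_ to _*ℤ_)
open import Data.List using (List; []; _∷_; map)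
open import Data.Product using (∃; ∃₂; _,_)
open import Relation.Binary.PropositionalEquality using (_≡_)
open import Relation.Unary using (Pred)

-- Polynomials in ℤ[x] as coefficient lists (lowest degree first).
-- Two lists represent the same polynomial iff all their coefficients agree
-- (so trailing zeros are irrelevant).
Poly : Set
Poly = List ℤ

coeff : Poly → ℕ → ℤ
coeff []      _       = + 0
coeff (a ∷ f) zero    = a
coeff (a ∷ f) (suc n) = coeff f n

infix 4 _≈P_
_≈P_ : Poly → Poly → Set
f ≈P g = ∀ n → coeff f n ≡ coeff g n

infixl 6 _+P_
_+P_ : Poly → Poly → Poly
[]      +P g       = g
(a ∷ f) +P []      = a ∷ f
(a ∷ f) +P (b ∷ g) = (a +ℤ b) ∷ (f +P g)

_·P_ : ℤ → Poly → Poly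
c ·P g = map (c *ℤ_) g

infixl 7 _*P_
_*P_ : Poly → Poly → Poly
[]      *P g = []
(a ∷ f) *P g = (a ·P g) +P (+ 0 ∷ (f *P g))

const : ℤ → Poly
const c = c ∷ []

infixr 8 _^P_
_^P_ : Poly → ℕ → Poly
f ^P zero  = const (+ 1)
f ^P suc n = f *P (f ^P n)

⟨_⟩ : Poly → Pred Poly 0ℓ
⟨ g ⟩ f = ∃ λ u → f ≈P u *P g

⟨_,_⟩ : Poly → Poly → Pred Poly 0ℓ
⟨ a , b ⟩ f = ∃₂ λ u v → f ≈P (u *P a) +P (v *P b)

quot : Pred Poly 0ℓ → Pred Poly 0ℓ → Pred Poly 0ℓ
quot I J f = ∀ h → J h → I (f *P h)

_∣P_ : Poly → Poly → Set
a ∣P b = ∃ λ q → b ≈P a *P q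

module Submission where

-- Call x cancellable if x a = x b ⇒ a = b,
-- and b regular modulo x if x ∣ g b ⇒ x ∣ g.  In any commutative ring:
--   * if A = x Q with x cancellable and B regular modulo x, then
--     ⟨A, B⟩ : ⟨x⟩ = ⟨Q, B⟩                                   (colon-first);
--   * if B = Ψ Φ with Ψ regular modulo C, then
--     ⟨C, B⟩ : ⟨Ψ⟩ = ⟨C, Φ⟩                                   (colon-second);
--   * both properties pass to products, hence to powers.
-- We then make the coefficient lists of Defs into a commutative ring ℤ[x],
-- show that p is cancellable in ℤ[x] and that φ is regular modulo p when
-- p ∤ φ (Gauss: ℤ/p[x] has no zero divisors, proved on coefficients), and
-- obtain the two statements with x = pⁱ, Q = pˡ⁻ⁱ, B = φᵐ, respectively
-- C = pˡ, Ψ = φʲ, Φ = φᵐ⁻ʲ.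

open import Defs
open import Level using (0ℓ; _⊔_)
open import Algebra using (CommutativeRing)
open import Data.Nat using (ℕ; zero; suc; _≤_; _∸_; NonZero) renaming (_+_ to _+ℕ_)
open import Data.Nat.Properties using (m+[n∸m]≡n)
open import Data.Nat.Primality using (Prime; euclidsLemma; prime⇒nonZero)
open import Data.Nat.Divisibility using (_∣?_) renaming (_∣_ to _∣ℕ_)
open import Data.Integer using (ℤ; +_)
import Data.Integer.Properties as ℤ
open import Data.List using ([]; _∷_; map)
open import Data.Product using (_×_)
open import Data.Sum using (inj₁; inj₂)
open import Relation.Nullary using (¬_; Dec; yes; no; contradiction)
open import Relation.Nullary.Decidable using (map′)
open import Relation.Unary using (Pred; _⊆_; _≐_)
open import Relation.Binary.Structures using (IsEquivalence)
open import Relation.Binary.PropositionalEquality using (_≡_)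
import Relation.Binary.PropositionalEquality as ≡

module ColonIdeals {c ℓ} (R : CommutativeRing c ℓ) where
  open import Data.Product using (∃; ∃₂; _,_; proj₁; proj₂)
  open CommutativeRing R
  open import Algebra.Properties.Ring ring using (x[y-z]≈xy-xz; [y-z]x≈yx-zx)
  open import Algebra.Properties.Group +-group using (//-rightDividesˡ; //-rightDividesʳ)
  open import Algebra.Properties.CommutativeSemigroup *-commutativeSemigroup using (x∙yz≈y∙xz)
  open import Algebra.Properties.Semiring.Exp semiring using (^-homo-*)
  open import Algebra.Properties.Semiring.Exp semiring public using (_^_)
  open import Algebra.Solver.Ring.NaturalCoefficients.Default commutativeSemiring
    using (solve; _:+_; _:*_; _:=_)
  open import Relation.Binary.Reasoning.Setoid setoid

  -- Divisibility, principal and two-generated ideals, and the ideal quotient,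
  -- shaped exactly as _∣P_, ⟨_⟩, ⟨_,_⟩ and quot of Defs.
  infix 4 _∣_
  _∣_ : Carrier → Carrier → Set (c ⊔ ℓ)
  a ∣ b = ∃ λ q → b ≈ a * q

  Ideal₁ : Carrier → Pred Carrier (c ⊔ ℓ)
  Ideal₁ g f = ∃ λ u → f ≈ u * g

  Ideal₂ : Carrier → Carrier → Pred Carrier (c ⊔ ℓ)
  Ideal₂ a b f = ∃₂ λ u v → f ≈ u * a + v * b

  Colon : Pred Carrier (c ⊔ ℓ) → Pred Carrier (c ⊔ ℓ) → Pred Carrier (c ⊔ ℓ)
  Colon I J f = ∀ h → J h → I (f * h)

  record Cancellable (x : Carrier) : Set (c ⊔ ℓ) where
    constructor cancellable
    field cancel : ∀ {a b} → x * a ≈ x * b → a ≈ b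
  open Cancellable public

  record RegularMod (x b : Carrier) : Set (c ⊔ ℓ) where
    constructor regularMod
    field drop-factor : ∀ g → x ∣ g * b → x ∣ g
  open RegularMod public

  1-cancellable : Cancellable 1#
  1-cancellable = cancellable λ {a} {b} 1a≈1b → begin
    a      ≈⟨ *-identityˡ a ⟨
    1# * a ≈⟨ 1a≈1b ⟩
    1# * b ≈⟨ *-identityˡ b ⟩
    b      ∎

  *-cancellable : ∀ {x y} → Cancellable x → Cancellable y → Cancellable (x * y)
  *-cancellable {x} {y} cx cy = cancellable λ {a} {b} xya≈xyb → cancel cy (cancel cx (begin
    x * (y * a) ≈⟨ *-assoc x y a ⟨
    x * y * a   ≈⟨ xya≈xyb ⟩
    x * y * b   ≈⟨ *-assoc x y b ⟩
    x * (y * b) ∎))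

  ^-cancellable : ∀ {x} → Cancellable x → ∀ k → Cancellable (x ^ k)
  ^-cancellable cx zero    = 1-cancellable
  ^-cancellable cx (suc k) = *-cancellable cx (^-cancellable cx k)

  regular-1 : ∀ {x} → RegularMod x 1#
  regular-1 = regularMod λ g (q , g1≈xq) → q , trans (sym (*-identityʳ g)) g1≈xq

  regular-* : ∀ {x b b′} → RegularMod x b → RegularMod x b′ → RegularMod x (b * b′)
  regular-* {x} {b} {b′} rb rb′ = regularMod λ g (q , gbb′≈xq) →
    drop-factor rb g (drop-factor rb′ (g * b) (q , trans (*-assoc g b b′) gbb′≈xq))

  regular-^ : ∀ {x b} → RegularMod x b → ∀ j → RegularMod x (b ^ j)
  regular-^ rb zero    = regular-1
  regular-^ rb (suc j) = regular-* rb (regular-^ rb j)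

  regular-mod-1 : ∀ {b} → RegularMod 1# b
  regular-mod-1 = regularMod λ g _ → g , sym (*-identityˡ g)

  -- If b is regular modulo x and modulo y, and x is cancellable, then b is
  -- regular modulo x y: from g b = x y q write g = x g′, cancel x to get
  -- g′ b = y q, and then g′ = y w.
  regular-mod-* : ∀ {x y b} → Cancellable x → RegularMod x b → RegularMod y b → RegularMod (x * y) b
  regular-mod-* {x} {y} {b} cx rx ry = regularMod divide
    where
    divide : ∀ g → x * y ∣ g * b → x * y ∣ g
    divide g (q , gb≈xyq) = w , (begin
        g           ≈⟨ g≈xg′ ⟩
        x * g′      ≈⟨ *-congˡ g′≈yw ⟩
        x * (y * w) ≈⟨ *-assoc x y w ⟨
        x * y * w   ∎)
      where
      x∣g : x ∣ g
      x∣g = drop-factor rx g (y * q , trans gb≈xyq (*-assoc x y q))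
      g′ : Carrier
      g′ = proj₁ x∣g
      g≈xg′ : g ≈ x * g′
      g≈xg′ = proj₂ x∣g
      g′b≈yq : g′ * b ≈ y * q
      g′b≈yq = cancel cx (begin
        x * (g′ * b) ≈⟨ *-assoc x g′ b ⟨
        x * g′ * b   ≈⟨ *-congʳ g≈xg′ ⟨
        g * b        ≈⟨ gb≈xyq ⟩
        x * y * q    ≈⟨ *-assoc x y q ⟩
        x * (y * q)  ∎)
      y∣g′ : y ∣ g′
      y∣g′ = drop-factor ry g′ (q , g′b≈yq)
      w : Carrier
      w = proj₁ y∣g′
      g′≈yw : g′ ≈ y * w
      g′≈yw = proj₂ y∣g′

  regular-mod-^ : ∀ {x b} → Cancellable x → RegularMod x b → ∀ k → RegularMod (x ^ k) b
  regular-mod-^ cx rx zero    = regular-mod-1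
  regular-mod-^ cx rx (suc k) = regular-mod-* cx rx (regular-mod-^ cx rx k)

  ^-split : ∀ x {i l} → i ≤ l → x ^ l ≈ x ^ i * x ^ (l ∸ i)
  ^-split x {i} {l} i≤l = begin
    x ^ l             ≡⟨ ≡.cong (x ^_) (m+[n∸m]≡n i≤l) ⟨
    x ^ (i +ℕ (l ∸ i)) ≈⟨ ^-homo-* x i (l ∸ i) ⟩
    x ^ i * x ^ (l ∸ i) ∎

  colon-first : ∀ {x Q A B} → Cancellable x → RegularMod x B → A ≈ x * Q →
                Colon (Ideal₂ A B) (Ideal₁ x) ≐ Ideal₂ Q B
  colon-first {x} {Q} {A} {B} cx rB A≈xQ = quot⊆ideal , ideal⊆quot
    where
    -- From f x = u A + v B, x divides v B, so v = x w by regularity, and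
    -- cancelling x from x f = x (u Q + w B) puts f in ⟨Q, B⟩.
    quot⊆ideal : Colon (Ideal₂ A B) (Ideal₁ x) ⊆ Ideal₂ Q B
    quot⊆ideal {f} f∈colon with f∈colon x (1# , sym (*-identityˡ x))
    ... | u , v , fx≈uA+vB = u , w , cancel cx (begin
        x * f                     ≈⟨ xf≈ ⟩
        v * B + x * (u * Q)       ≈⟨ +-comm _ _ ⟩
        x * (u * Q) + v * B       ≈⟨ +-congˡ (trans (*-congʳ v≈xw) (*-assoc x w B)) ⟩
        x * (u * Q) + x * (w * B) ≈⟨ distribˡ x (u * Q) (w * B) ⟨
        x * (u * Q + w * B)       ∎)
      where
      xf≈ : x * f ≈ v * B + x * (u * Q)
      xf≈ = begin
        x * f               ≈⟨ *-comm x f ⟩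
        f * x               ≈⟨ fx≈uA+vB ⟩
        u * A + v * B       ≈⟨ +-congʳ (trans (*-congˡ A≈xQ) (x∙yz≈y∙xz u x Q)) ⟩
        x * (u * Q) + v * B ≈⟨ +-comm _ _ ⟩
        v * B + x * (u * Q) ∎
      x∣vB : x ∣ v * B
      x∣vB = f - u * Q , sym (begin
        x * (f - u * Q)                   ≈⟨ x[y-z]≈xy-xz x f (u * Q) ⟩
        x * f - x * (u * Q)               ≈⟨ +-congʳ xf≈ ⟩
        v * B + x * (u * Q) - x * (u * Q) ≈⟨ //-rightDividesʳ (x * (u * Q)) (v * B) ⟩
        v * B                             ∎)
      w : Carrier
      w = proj₁ (drop-factor rB v x∣vB)
      v≈xw : v ≈ x * w
      v≈xw = proj₂ (drop-factor rB v x∣vB)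
    ideal⊆quot : Ideal₂ Q B ⊆ Colon (Ideal₂ A B) (Ideal₁ x)
    ideal⊆quot {f} (u , v , f≈uQ+vB) h (w , h≈wx) = u * w , v * (w * x) , (begin
      f * h                             ≈⟨ *-cong f≈uQ+vB h≈wx ⟩
      (u * Q + v * B) * (w * x)         ≈⟨ solve 6 (λ u Q v B w x →
                                             (u :* Q :+ v :* B) :* (w :* x)
                                               := u :* w :* (x :* Q) :+ v :* (w :* x) :* B)
                                             refl u Q v B w x ⟩
      u * w * (x * Q) + v * (w * x) * B ≈⟨ +-congʳ (*-congˡ A≈xQ) ⟨
      u * w * A + v * (w * x) * B       ∎)

  colon-second : ∀ {Ψ Φ B C} → RegularMod C Ψ → B ≈ Ψ * Φ →
                 Colon (Ideal₂ C B) (Ideal₁ Ψ) ≐ Ideal₂ C Φ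
  colon-second {Ψ} {Φ} {B} {C} rΨ B≈ΨΦ = quot⊆ideal , ideal⊆quot
    where
    -- From f Ψ = u C + v Ψ Φ, C divides (f - v Φ) Ψ, hence f - v Φ = C w by
    -- regularity, and f = w C + v Φ.
    quot⊆ideal : Colon (Ideal₂ C B) (Ideal₁ Ψ) ⊆ Ideal₂ C Φ
    quot⊆ideal {f} f∈colon with f∈colon Ψ (1# , sym (*-identityˡ Ψ))
    ... | u , v , fΨ≈uC+vB = w , v , (begin
        f                 ≈⟨ //-rightDividesˡ (v * Φ) f ⟨
        f - v * Φ + v * Φ ≈⟨ +-congʳ f-vΦ≈Cw ⟩
        C * w + v * Φ     ≈⟨ +-congʳ (*-comm C w) ⟩
        w * C + v * Φ     ∎)
      where
      C∣[f-vΦ]Ψ : C ∣ (f - v * Φ) * Ψ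
      C∣[f-vΦ]Ψ = u , (begin
        (f - v * Φ) * Ψ                 ≈⟨ [y-z]x≈yx-zx Ψ f (v * Φ) ⟩
        f * Ψ - v * Φ * Ψ               ≈⟨ +-congʳ (trans fΨ≈uC+vB (+-congˡ (*-congˡ B≈ΨΦ))) ⟩
        u * C + v * (Ψ * Φ) - v * Φ * Ψ ≈⟨ +-congʳ (solve 5 (λ u C v Ψ Φ →
                                             u :* C :+ v :* (Ψ :* Φ) := C :* u :+ v :* Φ :* Ψ)
                                             refl u C v Ψ Φ) ⟩
        C * u + v * Φ * Ψ - v * Φ * Ψ   ≈⟨ //-rightDividesʳ (v * Φ * Ψ) (C * u) ⟩
        C * u                           ∎)
      w : Carrier
      w = proj₁ (drop-factor rΨ (f - v * Φ) C∣[f-vΦ]Ψ)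
      f-vΦ≈Cw : f - v * Φ ≈ C * w
      f-vΦ≈Cw = proj₂ (drop-factor rΨ (f - v * Φ) C∣[f-vΦ]Ψ)
    ideal⊆quot : Ideal₂ C Φ ⊆ Colon (Ideal₂ C B) (Ideal₁ Ψ)
    ideal⊆quot {f} (u , v , f≈uC+vΦ) h (w , h≈wΨ) = u * (w * Ψ) , v * w , (begin
      f * h                             ≈⟨ *-cong f≈uC+vΦ h≈wΨ ⟩
      (u * C + v * Φ) * (w * Ψ)         ≈⟨ solve 6 (λ u C v Φ w Ψ →
                                             (u :* C :+ v :* Φ) :* (w :* Ψ)
                                               := u :* (w :* Ψ) :* C :+ v :* w :* (Ψ :* Φ))
                                             refl u C v Φ w Ψ ⟩
      u * (w * Ψ) * C + v * w * (Ψ * Φ) ≈⟨ +-congˡ (*-congˡ B≈ΨΦ) ⟨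
      u * (w * Ψ) * C + v * w * B       ∎)

module PolynomialRing where
  open import Data.Integer using (-_; _+_; _*_)
  open import Data.Integer.Tactic.RingSolver using (solve-∀)
  open ≡ using (refl; sym; trans; cong; cong₂; module ≡-Reasoning)
  open import Data.Product using (_,_)

  coeff-+ : ∀ f g n → coeff (f +P g) n ≡ coeff f n + coeff g n
  coeff-+ []      g       n       = sym (ℤ.+-identityˡ _)
  coeff-+ (a ∷ f) []      n       = sym (ℤ.+-identityʳ _)
  coeff-+ (a ∷ f) (b ∷ g) zero    = refl
  coeff-+ (a ∷ f) (b ∷ g) (suc n) = coeff-+ f g n

  coeff-· : ∀ c g n → coeff (c ·P g) n ≡ c * coeff g n
  coeff-· c []      n       = sym (ℤ.*-zeroʳ c)
  coeff-· c (b ∷ g) zero    = refl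
  coeff-· c (b ∷ g) (suc n) = coeff-· c g n

  negP : Poly → Poly
  negP = map -_

  coeff-neg : ∀ g n → coeff (negP g) n ≡ - coeff g n
  coeff-neg []      n       = refl
  coeff-neg (b ∷ g) zero    = refl
  coeff-neg (b ∷ g) (suc n) = coeff-neg g n

  coeff-*-zero : ∀ a f g → coeff ((a ∷ f) *P g) 0 ≡ a * coeff g 0
  coeff-*-zero a f g rewrite coeff-+ (a ·P g) (+ 0 ∷ f *P g) 0 | coeff-· a g 0 = ℤ.+-identityʳ _

  coeff-*-suc : ∀ a f g n → coeff ((a ∷ f) *P g) (suc n) ≡ a * coeff g (suc n) + coeff (f *P g) n
  coeff-*-suc a f g n rewrite coeff-+ (a ·P g) (+ 0 ∷ f *P g) (suc n) | coeff-· a g (suc n) = refl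

  coeff-const-* : ∀ c f n → coeff (const c *P f) n ≡ c * coeff f n
  coeff-const-* c f zero    = coeff-*-zero c [] f
  coeff-const-* c f (suc n) = trans (coeff-*-suc c [] f n) (ℤ.+-identityʳ _)

  ≈P-isEquivalence : IsEquivalence _≈P_
  ≈P-isEquivalence = record
    { refl  = λ n → refl
    ; sym   = λ e n → sym (e n)
    ; trans = λ e e′ n → trans (e n) (e′ n)
    }

  +P-cong : ∀ {f f′ g g′} → f ≈P f′ → g ≈P g′ → f +P g ≈P f′ +P g′
  +P-cong {f} {f′} {g} {g′} e e′ n
    rewrite coeff-+ f g n | coeff-+ f′ g′ n = cong₂ _+_ (e n) (e′ n)

  +P-assoc : ∀ f g h → (f +P g) +P h ≈P f +P (g +P h)
  +P-assoc f g h n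
    rewrite coeff-+ (f +P g) h n | coeff-+ f g n | coeff-+ f (g +P h) n | coeff-+ g h n =
    ℤ.+-assoc (coeff f n) (coeff g n) (coeff h n)

  +P-comm : ∀ f g → f +P g ≈P g +P f
  +P-comm f g n rewrite coeff-+ f g n | coeff-+ g f n = ℤ.+-comm (coeff f n) (coeff g n)

  +P-congˡ : ∀ f {g g′} → g ≈P g′ → f +P g ≈P f +P g′
  +P-congˡ f {g} {g′} = +P-cong {f} {f} {g} {g′} (λ n → refl)

  +P-identityˡ : ∀ f → [] +P f ≈P f
  +P-identityˡ f n = refl

  +P-identityʳ : ∀ f → f +P [] ≈P f
  +P-identityʳ f n = trans (coeff-+ f [] n) (ℤ.+-identityʳ _)

  negP-cong : ∀ {f g} → f ≈P g → negP f ≈P negP g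
  negP-cong {f} {g} e n rewrite coeff-neg f n | coeff-neg g n = cong -_ (e n)

  negP-inverseˡ : ∀ f → negP f +P f ≈P []
  negP-inverseˡ f n rewrite coeff-+ (negP f) f n | coeff-neg f n = ℤ.+-inverseˡ (coeff f n)

  negP-inverseʳ : ∀ f → f +P negP f ≈P []
  negP-inverseʳ f n rewrite coeff-+ f (negP f) n | coeff-neg f n = ℤ.+-inverseʳ (coeff f n)

  *P-congˡ : ∀ f {g g′} → g ≈P g′ → f *P g ≈P f *P g′
  *P-congˡ []      e n       = refl
  *P-congˡ (a ∷ f) {g} {g′} e zero
    rewrite coeff-*-zero a f g | coeff-*-zero a f g′ = cong (a *_) (e 0)
  *P-congˡ (a ∷ f) {g} {g′} e (suc n)
    rewrite coeff-*-suc a f g n | coeff-*-suc a f g′ n =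
    cong₂ _+_ (cong (a *_) (e (suc n))) (*P-congˡ f e n)

  *P-distribˡ : ∀ f g h → f *P (g +P h) ≈P f *P g +P f *P h
  *P-distribˡ []      g h n       = refl
  *P-distribˡ (a ∷ f) g h zero
    rewrite coeff-*-zero a f (g +P h) | coeff-+ ((a ∷ f) *P g) ((a ∷ f) *P h) 0
          | coeff-*-zero a f g | coeff-*-zero a f h | coeff-+ g h 0 =
    ℤ.*-distribˡ-+ a (coeff g 0) (coeff h 0)
  *P-distribˡ (a ∷ f) g h (suc n)
    rewrite coeff-*-suc a f (g +P h) n | coeff-+ ((a ∷ f) *P g) ((a ∷ f) *P h) (suc n)
          | coeff-*-suc a f g n | coeff-*-suc a f h n | coeff-+ g h (suc n)
          | *P-distribˡ f g h n | coeff-+ (f *P g) (f *P h) n =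
    regroup a (coeff g (suc n)) (coeff h (suc n)) (coeff (f *P g) n) (coeff (f *P h) n)
    where
    regroup : ∀ a x y u v → a * (x + y) + (u + v) ≡ (a * x + u) + (a * y + v)
    regroup = solve-∀

  ·P-*P : ∀ c f g → (c ·P f) *P g ≈P c ·P (f *P g)
  ·P-*P c []      g n       = refl
  ·P-*P c (a ∷ f) g zero
    rewrite coeff-*-zero (c * a) (c ·P f) g | coeff-· c ((a ∷ f) *P g) 0 | coeff-*-zero a f g =
    ℤ.*-assoc c a (coeff g 0)
  ·P-*P c (a ∷ f) g (suc n)
    rewrite coeff-*-suc (c * a) (c ·P f) g n | coeff-· c ((a ∷ f) *P g) (suc n) | coeff-*-suc a f g n
          | ·P-*P c f g n | coeff-· c (f *P g) n =
    regroup c a (coeff g (suc n)) (coeff (f *P g) n)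
    where
    regroup : ∀ c a x u → c * a * x + c * u ≡ c * (a * x + u)
    regroup = solve-∀

  *P-const : ∀ f c → f *P const c ≈P c ·P f
  *P-const []      c n       = refl
  *P-const (a ∷ f) c zero    = trans (coeff-*-zero a f (const c)) (ℤ.*-comm a c)
  *P-const (a ∷ f) c (suc n) rewrite coeff-*-suc a f (const c) n | *P-const f c n | ℤ.*-zeroʳ a =
    ℤ.+-identityˡ _

  *P-shift : ∀ f g → f *P (+ 0 ∷ g) ≈P + 0 ∷ (f *P g)
  *P-shift []      g zero          = refl
  *P-shift []      g (suc n)       = refl
  *P-shift (a ∷ f) g zero          = trans (coeff-*-zero a f (+ 0 ∷ g)) (ℤ.*-zeroʳ a)
  *P-shift (a ∷ f) g (suc zero)
    rewrite coeff-*-suc a f (+ 0 ∷ g) 0 | *P-shift f g 0 | coeff-*-zero a f g = ℤ.+-identityʳ _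
  *P-shift (a ∷ f) g (suc (suc n))
    rewrite coeff-*-suc a f (+ 0 ∷ g) (suc n) | *P-shift f g (suc n) | coeff-*-suc a f g n = refl

  shift-*P : ∀ f g → (+ 0 ∷ f) *P g ≈P + 0 ∷ (f *P g)
  shift-*P f g zero    = coeff-*-zero (+ 0) f g
  shift-*P f g (suc n) = trans (coeff-*-suc (+ 0) f g n) (ℤ.+-identityˡ _)

  *P-nil : ∀ f → f *P [] ≈P []
  *P-nil []      n       = refl
  *P-nil (a ∷ f) zero    = trans (coeff-*-zero a f []) (ℤ.*-zeroʳ a)
  *P-nil (a ∷ f) (suc n) rewrite coeff-*-suc a f [] n | *P-nil f n | ℤ.*-zeroʳ a = refl

  ∷-cong : ∀ {a f g} → f ≈P g → a ∷ f ≈P a ∷ g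
  ∷-cong e zero    = refl
  ∷-cong e (suc n) = e n

  cons-split : ∀ a f → a ∷ f ≈P const a +P (+ 0 ∷ f)
  cons-split a f zero    = sym (ℤ.+-identityʳ a)
  cons-split a f (suc n) = refl

  *P-cons : ∀ g a f → g *P (a ∷ f) ≈P a ·P g +P (+ 0 ∷ g *P f)
  *P-cons g a f n = begin
    coeff (g *P (a ∷ f)) n                          ≡⟨ *P-congˡ g {a ∷ f} (cons-split a f) n ⟩
    coeff (g *P (const a +P (+ 0 ∷ f))) n           ≡⟨ *P-distribˡ g (const a) (+ 0 ∷ f) n ⟩
    coeff (g *P const a +P g *P (+ 0 ∷ f)) n        ≡⟨ +P-cong {g *P const a} {a ·P g}
                                                          (*P-const g a) (*P-shift g f) n ⟩
    coeff (a ·P g +P (+ 0 ∷ g *P f)) n              ∎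
    where open ≡-Reasoning

  coeff-*-cons-suc : ∀ g b h n → coeff (g *P (b ∷ h)) (suc n) ≡ b * coeff g (suc n) + coeff (g *P h) n
  coeff-*-cons-suc g b h n = begin
    coeff (g *P (b ∷ h)) (suc n)                   ≡⟨ *P-cons g b h (suc n) ⟩
    coeff (b ·P g +P (+ 0 ∷ g *P h)) (suc n)       ≡⟨ coeff-+ (b ·P g) (+ 0 ∷ g *P h) (suc n) ⟩
    coeff (b ·P g) (suc n) + coeff (g *P h) n      ≡⟨ cong (_+ coeff (g *P h) n) (coeff-· b g (suc n)) ⟩
    b * coeff g (suc n) + coeff (g *P h) n         ∎
    where open ≡-Reasoning

  *P-comm : ∀ f g → f *P g ≈P g *P f
  *P-comm []      g n = sym (*P-nil g n)
  *P-comm (a ∷ f) g n = begin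
    coeff (a ·P g +P (+ 0 ∷ f *P g)) n  ≡⟨ +P-congˡ (a ·P g) (∷-cong (*P-comm f g)) n ⟩
    coeff (a ·P g +P (+ 0 ∷ g *P f)) n  ≡⟨ *P-cons g a f n ⟨
    coeff (g *P (a ∷ f)) n              ∎
    where open ≡-Reasoning

  *P-congʳ : ∀ {f f′} g → f ≈P f′ → f *P g ≈P f′ *P g
  *P-congʳ {f} {f′} g e n = trans (*P-comm f g n) (trans (*P-congˡ g {f} {f′} e n) (*P-comm g f′ n))

  *P-cong : ∀ {f f′ g g′} → f ≈P f′ → g ≈P g′ → f *P g ≈P f′ *P g′
  *P-cong {f} {f′} {g} {g′} e e′ n = trans (*P-congʳ {f} {f′} g e n) (*P-congˡ f′ {g} {g′} e′ n)

  *P-distribʳ : ∀ f g h → (f +P g) *P h ≈P f *P h +P g *P h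
  *P-distribʳ f g h n = begin
    coeff ((f +P g) *P h) n       ≡⟨ *P-comm (f +P g) h n ⟩
    coeff (h *P (f +P g)) n       ≡⟨ *P-distribˡ h f g n ⟩
    coeff (h *P f +P h *P g) n    ≡⟨ +P-cong {h *P f} {f *P h} (*P-comm h f) (*P-comm h g) n ⟩
    coeff (f *P h +P g *P h) n    ∎
    where open ≡-Reasoning

  *P-assoc : ∀ f g h → (f *P g) *P h ≈P f *P (g *P h)
  *P-assoc []      g h n = refl
  *P-assoc (a ∷ f) g h n = begin
    coeff ((a ·P g +P (+ 0 ∷ f *P g)) *P h) n          ≡⟨ *P-distribʳ (a ·P g) (+ 0 ∷ f *P g) h n ⟩
    coeff ((a ·P g) *P h +P (+ 0 ∷ f *P g) *P h) n     ≡⟨ +P-cong {(a ·P g) *P h} {a ·P (g *P h)}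
                                                             (·P-*P a g h) (shift-*P (f *P g) h) n ⟩
    coeff (a ·P (g *P h) +P (+ 0 ∷ (f *P g) *P h)) n   ≡⟨ +P-congˡ (a ·P (g *P h)) (∷-cong (*P-assoc f g h)) n ⟩
    coeff (a ·P (g *P h) +P (+ 0 ∷ f *P (g *P h))) n   ∎
    where open ≡-Reasoning

  *P-identityˡ : ∀ f → const (+ 1) *P f ≈P f
  *P-identityˡ f n = trans (coeff-const-* (+ 1) f n) (ℤ.*-identityˡ _)

  *P-identityʳ : ∀ f → f *P const (+ 1) ≈P f
  *P-identityʳ f n = trans (*P-comm f (const (+ 1)) n) (*P-identityˡ f n)

  ℤ[x] : CommutativeRing 0ℓ 0ℓ
  ℤ[x] = record
    { Carrier = Poly ; _≈_ = _≈P_ ; _+_ = _+P_ ; _*_ = _*P_ ; -_ = negP ; 0# = [] ; 1# = const (+ 1)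
    ; isCommutativeRing = record
      { isRing = record
        { +-isAbelianGroup = record
          { isGroup = record
            { isMonoid = record
              { isSemigroup = record
                { isMagma = record
                  { isEquivalence = ≈P-isEquivalence
                  ; ∙-cong        = λ {f} {f′} {g} {g′} → +P-cong {f} {f′} {g} {g′} }
                ; assoc   = +P-assoc }
              ; identity = +P-identityˡ , +P-identityʳ }
            ; inverse = negP-inverseˡ , negP-inverseʳ
            ; ⁻¹-cong = λ {f} {g} → negP-cong {f} {g} }
          ; comm = +P-comm }
        ; *-cong     = λ {f} {f′} {g} {g′} → *P-cong {f} {f′} {g} {g′}
        ; *-assoc    = *P-assoc
        ; *-identity = *P-identityˡ , *P-identityʳ
        ; distrib    = *P-distribˡ , λ h f g → *P-distribʳ f g h }
      ; *-comm = *P-comm } }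

open PolynomialRing using (ℤ[x])
open ColonIdeals ℤ[x]
open PolynomialRing using (coeff-*-zero; coeff-*-suc; coeff-*-cons-suc; coeff-const-*; *P-nil; *P-comm)

^P≡^ : ∀ f n → f ^P n ≡ f ^ n
^P≡^ f zero    = ≡.refl
^P≡^ f (suc n) = ≡.cong (f *P_) (^P≡^ f n)

^P-split : ∀ f {i l} → i ≤ l → f ^P l ≈P f ^P i *P f ^P (l ∸ i)
^P-split f {i} {l} i≤l rewrite ^P≡^ f l | ^P≡^ f i | ^P≡^ f (l ∸ i) = ^-split f i≤l

-- The constant polynomial p, for a prime p, is cancellable in ℤ[x], and every
-- φ with p ∤ φ is regular modulo p.  Divisibility by p is tested on
-- coefficients, where Euclid's lemma applies.
module ModPrime (p : ℕ) (p-prime : Prime p) where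
  open import Data.Integer using (_+_; _*_; ∣_∣)
  open import Data.Integer.Divisibility.Signed
    using (divides; ∣ᵤ⇒∣; ∣⇒∣ᵤ; ∣m+n∣m⇒∣n; ∣m⇒∣m*n) renaming (_∣_ to _∣ℤ_)
  open ≡ using (refl; sym; trans; cong; subst)
  open import Data.Product using (_,_)

  P : Poly
  P = const (+ p)

  instance
    p-nonZero : NonZero p
    p-nonZero = prime⇒nonZero p-prime

  p∣coeffs : Poly → Set
  p∣coeffs f = ∀ n → + p ∣ℤ coeff f n

  P-cancellable : Cancellable P
  P-cancellable = cancellable λ {a} {b} Pa≈Pb n → ℤ.*-cancelˡ-≡ (+ p) (coeff a n) (coeff b n)
    (trans (sym (coeff-const-* (+ p) a n)) (trans (Pa≈Pb n) (coeff-const-* (+ p) b n)))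

  P∣⇒p∣coeffs : ∀ f → P ∣ f → p∣coeffs f
  P∣⇒p∣coeffs f (q , f≈Pq) n =
    divides (coeff q n) (trans (f≈Pq n) (trans (coeff-const-* (+ p) q n) (ℤ.*-comm (+ p) (coeff q n))))

  p∣coeffs⇒P∣ : ∀ f → p∣coeffs f → P ∣ f
  p∣coeffs⇒P∣ f p∣ = quotient-by-p f p∣ , λ n →
    trans (coeff-quotient f p∣ n) (sym (coeff-const-* (+ p) (quotient-by-p f p∣) n))
    where
    quotient-by-p : ∀ f → p∣coeffs f → Poly
    quotient-by-p []      _  = []
    quotient-by-p (a ∷ f) p∣ = _∣ℤ_.quotient (p∣ 0) ∷ quotient-by-p f (λ n → p∣ (suc n))
    coeff-quotient : ∀ f (p∣ : p∣coeffs f) n → coeff f n ≡ + p * coeff (quotient-by-p f p∣) n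
    coeff-quotient []      p∣ n       = sym (ℤ.*-zeroʳ (+ p))
    coeff-quotient (a ∷ f) p∣ zero    = trans (_∣ℤ_.equality (p∣ 0)) (ℤ.*-comm _ (+ p))
    coeff-quotient (a ∷ f) p∣ (suc n) = coeff-quotient f (λ k → p∣ (suc k)) n

  p∣? : ∀ a → Dec (+ p ∣ℤ a)
  p∣? a = map′ ∣ᵤ⇒∣ ∣⇒∣ᵤ (p ∣? ∣ a ∣)

  p∣*⇒p∣ : ∀ a b → + p ∣ℤ a * b → ¬ (+ p ∣ℤ a) → + p ∣ℤ b
  p∣*⇒p∣ a b p∣ab p∤a with euclidsLemma ∣ a ∣ ∣ b ∣ p-prime (subst (p ∣ℕ_) (ℤ.abs-* a b) (∣⇒∣ᵤ p∣ab))
  ... | inj₁ p∣a = contradiction (∣ᵤ⇒∣ p∣a) p∤a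
  ... | inj₂ p∣b = ∣ᵤ⇒∣ p∣b

  p∣b : ∀ a f b g → ¬ (+ p ∣ℤ a) → p∣coeffs ((a ∷ f) *P (b ∷ g)) → + p ∣ℤ b
  p∣b a f b g p∤a p∣ = p∣*⇒p∣ a b (subst (+ p ∣ℤ_) (coeff-*-zero a f (b ∷ g)) (p∣ 0)) p∤a

  p∣coeffs-tail : ∀ a f g → + p ∣ℤ a → p∣coeffs ((a ∷ f) *P g) → p∣coeffs (f *P g)
  p∣coeffs-tail a f g p∣a p∣ n =
    ∣m+n∣m⇒∣n (subst (+ p ∣ℤ_) (coeff-*-suc a f g n) (p∣ (suc n)))
              (∣m⇒∣m*n (coeff g (suc n)) p∣a)

  -- If p ∤ a and p divides (a ∷ f) g coefficientwise, then p divides every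
  -- coefficient of g: the constant term a b gives p ∣ b, and then b may be
  -- dropped from g.
  gauss-p∤head : ∀ a f g → ¬ (+ p ∣ℤ a) → p∣coeffs ((a ∷ f) *P g) → p∣coeffs g
  gauss-p∤head a f []      p∤a _  n       = divides (+ 0) refl
  gauss-p∤head a f (b ∷ g) p∤a p∣ zero    = p∣b a f b g p∤a p∣
  gauss-p∤head a f (b ∷ g) p∤a p∣ (suc n) = gauss-p∤head a f g p∤a p∣tail n
    where
    p∣tail : p∣coeffs ((a ∷ f) *P g)
    p∣tail k = ∣m+n∣m⇒∣n (subst (+ p ∣ℤ_) (coeff-*-cons-suc (a ∷ f) b g k) (p∣ (suc k)))
                         (∣m⇒∣m*n (coeff (a ∷ f) (suc k)) (p∣b a f b g p∤a p∣))

  -- Gauss: ℤ/p[x] has no zero divisors.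
  gauss : ∀ f g → ¬ p∣coeffs f → p∣coeffs (f *P g) → p∣coeffs g
  gauss []      g p∤f _ = contradiction (λ n → divides (+ 0) refl) p∤f
  gauss (a ∷ f) g p∤f p∣ with p∣? a
  ... | yes p∣a = gauss f g (λ p∣f → p∤f (λ where zero → p∣a ; (suc n) → p∣f n))
                            (p∣coeffs-tail a f g p∣a p∣)
  ... | no  p∤a = gauss-p∤head a f g p∤a p∣

  regular-mod-P : ∀ φ → ¬ (P ∣P φ) → RegularMod P φ
  regular-mod-P φ P∤φ = regularMod λ g P∣gφ → p∣coeffs⇒P∣ g (gauss φ g p∤φ (p∣φg g P∣gφ))
    where
    p∤φ : ¬ p∣coeffs φ
    p∤φ p∣φ = P∤φ (p∣coeffs⇒P∣ φ p∣φ)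
    p∣φg : ∀ g → P ∣ g *P φ → p∣coeffs (φ *P g)
    p∣φg g P∣gφ n = subst (+ p ∣ℤ_) (*P-comm g φ n) (P∣⇒p∣coeffs (g *P φ) P∣gφ n)

  Pᵏ-cancellable : ∀ k → Cancellable (P ^P k)
  Pᵏ-cancellable k = ≡.subst Cancellable (≡.sym (^P≡^ P k)) (^-cancellable P-cancellable k)

  φʲ-regular-mod-Pᵏ : ∀ φ → ¬ (P ∣P φ) → ∀ k j → RegularMod (P ^P k) (φ ^P j)
  φʲ-regular-mod-Pᵏ φ P∤φ k j = ≡.subst₂ RegularMod (≡.sym (^P≡^ P k)) (≡.sym (^P≡^ φ j))
    (regular-mod-^ P-cancellable (regular-^ (regular-mod-P φ P∤φ) j) k)

claim2 : (p : ℕ) → Prime p → (φ : Poly) → ¬ (const (+ p) ∣P φ) → (l m : ℕ) →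
    ((i : ℕ) → i ≤ l →
      quot ⟨ const (+ p) ^P l , φ ^P m ⟩ ⟨ const (+ p) ^P i ⟩ ≐ ⟨ const (+ p) ^P (l ∸ i) , φ ^P m ⟩)
    × ((j : ℕ) → j ≤ m →
      quot ⟨ const (+ p) ^P l , φ ^P m ⟩ ⟨ φ ^P j ⟩ ≐ ⟨ const (+ p) ^P l , φ ^P (m ∸ j) ⟩)
claim2 p p-prime φ P∤φ l m =
    (λ i i≤l → colon-first (Pᵏ-cancellable i) (φʲ-regular-mod-Pᵏ φ P∤φ i m) (^P-split P i≤l))
  , (λ j j≤m → colon-second (φʲ-regular-mod-Pᵏ φ P∤φ l j) (^P-split φ j≤m))
  where
  open import Data.Product using (_,_)
  open ModPrime p p-prime
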